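{- Let $G$ be a finite group and let $\mathcal{M}(G)$ be the set of all $R\in\mathcal{R}(G)$ satisfying all of: (A) $\overline{R}\neq R$; (B) $[R,G]_{rk}=\{R\}\cup[\overline{R},G]_{rk}$; (C) every element of $[\overline{R},G]_{rk}$ is closed; (D) $\mathrm{Int}([\emptyset,\overline{R}]_{rk})$ is not (isomorphic to) a Boolean algebra. Then: (1) every $R\in\mathcal{M}(G)$ is a non-normal subgroup of $G$; (2) every non-normal maximal subgroup $M$ of $G$ belongs to $\mathcal{M}(G)$.
   Context: A subrack of a group $G$ is a subset $Q\subseteq G$ with $aba^{ -1}\in Q$ and $a^{ -1}ba\in Q$ for all $a,b\in Q$ (including $\emptyset$); $\mathcal{R}(G)$ is the lattice of subracks ordered by inclusion. For subracks $S\subseteq T$, $[S,T]_{rk}=\{Q\in\mathcal{R}(G): S\subseteq Q\subseteq T\}$. For $R\in\mathcal{R}(G)$, its closure $\overline{R}$ is the union of all conjugacy classes $C$ of $G$ with $C\cap R\neq\emptyset$; $R$ is closed if $R=\overline{R}$. For a finite lattice $L$, $\mathrm{Int}(L)$ is the subposet of $L$ consisting of all elements that are meets of some set of coatoms of $L$. -}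

module Defs where

open import Level using (0ℓ)
open import Data.Nat using (ℕ)
open import Data.Fin using (Fin; _≟_)
open import Data.Fin.Properties using (any?)
open import Data.Fin.Subset using (Subset; _∈_; _∉_; _⊆_; ⊤; ⊥; _∩_)
open import Data.Fin.Subset.Properties using (_∈?_)
open import Data.Product using (Σ; ∃; _×_; _,_; proj₁)
open import Data.Sum using (_⊎_)
open import Data.List using (List)
open import Data.List.Relation.Unary.All using (All)
open import Data.List.Membership.Propositional as LM using ()
open import Relation.Nullary using (¬_; does)
open import Relation.Nullary.Decidable using (_×-dec_)
open import Relation.Binary.PropositionalEquality using (_≡_; _≢_)
open import Function.Bundles using (_⇔_)
open import Algebra.Structures using (IsGroup)
open import Data.Vec using (tabulate)

-- A finite group of order n, with carrier Fin n and equality _≡_.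
-- (Every finite group is isomorphic to one of this form.)
record FinGroup (n : ℕ) : Set where
  infixl 7 _∙_
  field
    _∙_     : Fin n → Fin n → Fin n
    ε       : Fin n
    _⁻¹     : Fin n → Fin n
    isGroup : IsGroup _≡_ _∙_ ε _⁻¹

-- Generic order-theoretic notions for a family of subsets of Fin n
-- (a "subposet" given by a membership predicate, ordered by inclusion).

module _ {n : ℕ} (L : Subset n → Set) where

  IsCoatom : Subset n → Subset n → Set
  IsCoatom top C = L C × C ⊆ top × C ≢ top
                 × (∀ W → L W → C ⊆ W → W ⊆ top → W ≡ C ⊎ W ≡ top)

  IsMeetIn : List (Subset n) → Subset n → Set
  IsMeetIn S Q = L Q × All (λ X → Q ⊆ X) S
               × (∀ W → L W → All (λ X → W ⊆ X) S → W ⊆ Q)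

  InInt : Subset n → Subset n → Set
  InInt top Q = Σ (List (Subset n)) λ S → All (IsCoatom top) S × IsMeetIn S Q

IsoToBoolean : {n : ℕ} → (Subset n → Set) → Set
IsoToBoolean {n} P =
  Σ ℕ λ k →
  Σ (Σ (Subset n) P → Subset k) λ f →
  Σ (Subset k → Σ (Subset n) P) λ g →
    (∀ x → proj₁ (g (f x)) ≡ proj₁ x)
  × (∀ y → f (g y) ≡ y)
  × (∀ x y → (proj₁ x ⊆ proj₁ y) ⇔ (f x ⊆ f y))

module _ {n : ℕ} (G : FinGroup n) where
  open FinGroup G

  IsSubrack : Subset n → Set
  IsSubrack Q = ∀ a b → a ∈ Q → b ∈ Q →
                ((a ∙ b) ∙ (a ⁻¹)) ∈ Q × ((a ⁻¹ ∙ b) ∙ a) ∈ Q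

  InInterval : Subset n → Subset n → Subset n → Set
  InInterval S T Q = IsSubrack Q × S ⊆ Q × Q ⊆ T

  closure : Subset n → Subset n
  closure R = tabulate λ x →
    does (any? λ y → any? λ g → (y ∈? R) ×-dec (x ≟ ((g ∙ y) ∙ (g ⁻¹))))

  IsClosed : Subset n → Set
  IsClosed R = closure R ≡ R

  InM : Subset n → Set
  InM R =
      IsSubrack R
    × closure R ≢ R
    × (∀ Q → InInterval R ⊤ Q ⇔ (Q ≡ R ⊎ InInterval (closure R) ⊤ Q))
    × (∀ Q → InInterval (closure R) ⊤ Q → IsClosed Q)
    × ¬ IsoToBoolean (InInt (InInterval ⊥ (closure R)) (closure R))

  IsSubgroup : Subset n → Set
  IsSubgroup H = ε ∈ H × (∀ a b → a ∈ H → b ∈ H → (a ∙ b) ∈ H)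
               × (∀ a → a ∈ H → (a ⁻¹) ∈ H)

  IsNormal : Subset n → Set
  IsNormal H = ∀ g h → h ∈ H → ((g ∙ h) ∙ (g ⁻¹)) ∈ H

  IsMaximalSubgroup : Subset n → Set
  IsMaximalSubgroup M = IsSubgroup M × M ≢ ⊤
                      × (∀ H → IsSubgroup H → M ⊆ H → H ≡ M ⊎ H ≡ ⊤)

-- Let R ∈ 𝓜(G) and let N be its normaliser, a subgroup containing R. Applying (B) to the
-- subrack R ∪ (N ─ closure R) shows N ⊆ closure R, and applying it to N gives N = R or closure R ⊆ N.
-- In the second case closure R = N is a subgroup C, and then Int([∅, C]) is Boolean: by Jordan's
-- theorem a subrack of C meeting every C-conjugacy class is C, so the coatoms are the complements of
-- single classes and their meets are exactly the unions of classes. This contradicts (D), so R = N is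
-- a subgroup, and (A) says it is not normal. A subrack strictly containing a maximal subgroup M has normaliser G, hence is a union of
-- conjugacy classes; this gives (B) and (C), and (A) holds as M is not normal. The conjugates g M g⁻¹
-- are coatoms of [∅, closure M], those with g ∉ M differ from M because M is self-normalising, and
-- their meet lies in M since z ∉ z M z⁻¹ for z ∉ M. In a Boolean algebra no coatom lies above a meet
-- of other coatoms, which gives (D).

module Submission where

open import Defs
open import Data.Nat using (ℕ; zero; suc; _+_; _*_; _∸_; _≤_; _<_; z≤n)
import Data.Nat.Properties as ℕ
open import Data.Bool using (true; false; if_then_else_)
import Data.Bool.Properties as Bool
open import Data.Fin using (Fin; zero; suc; _≟_; toℕ; punchIn; inject; fromℕ<) renaming (_≤_ to _≤ᶠ_)
open import Data.Fin.Properties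
  using (any?; all?; ¬∀⟶∃¬; ¬∀⟶∃¬-smallest; punchInᵢ≢i; toℕ-injective; toℕ-inject; toℕ-fromℕ<)
  renaming (_≤?_ to _≤ᶠ?_; ≤-antisym to ≤ᶠ-antisym)
open import Data.Fin.Permutation using (permutation)
open import Data.Fin.Subset using (Subset; _∈_; _∉_; _⊆_; _⊂_; ⊤; ⊥; _∩_; _∪_; _─_; ⋂; ⁅_⁆; ∣_∣)
open import Data.Fin.Subset.Properties
  using ( _∈?_; ∈⊤; ⊥⊆; ⊆⊤; ⊆-refl; ⊆-reflexive; ⊆-trans; ⊆-antisym; drop-∷-⊆; p⊆p∪q; p∩q⊆p; p∩q⊆q
        ; p─q⊆p; x∈p∩q⁺; x∈p∩q⁻; x∈p∪q⁺; x∈p∪q⁻; x∈p∧x∉q⇒x∈p─q; x∈⁅x⁆; x∈⁅y⁆⇒x≡y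
        ; p⊆q⇒∣p∣≤∣q∣; p⊂q⇒∣p∣<∣q∣)
open import Data.Vec using ([]; _∷_; tabulate; here; there)
open import Data.Vec.Properties using (≡-dec; lookup∘tabulate; lookup⇒[]=; []=⇒lookup; ∷-injective; ∷-injectiveʳ)
open import Data.Product using (Σ; ∃; _×_; _,_; proj₁; proj₂)
open import Data.Sum using (_⊎_; inj₁; inj₂; [_,_]′)
open import Data.List using (List; []; _∷_; map; filter; allFin)
open import Data.List.Relation.Unary.All using (All; []; _∷_)
import Data.List.Relation.Unary.All as All
open import Data.List.Relation.Unary.All.Properties using (map⁺; map⁻; all-filter)
open import Data.List.Membership.Propositional.Properties using (∈-filter⁺; ∈-allFin)
open import Relation.Nullary using (¬_; ¬?; Dec; yes; no; does; contradiction)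
open import Relation.Nullary.Decidable using (_×-dec_; _→-dec_; dec-true; dec-false; does-⇔; decidable-stable)
open import Relation.Binary.PropositionalEquality
open import Function using (_∘_; id)
open import Function.Bundles using (_⇔_; mk⇔; Equivalence)
open import Level using (0ℓ)
open import Algebra.Bundles using (Group)
open import Algebra.Structures using (IsGroup)
import Algebra.Properties.Group as GroupProperties
open import Algebra.Properties.Semiring.Sum ℕ.+-*-semiring
  using ( sum; sum-syntax; sum-cong-≗; sum-replicate-zero; sum-remove; sum-permute
        ; ∑-comm; ∑-distrib-+; *-distribʳ-sum)

¬[A→B]⇒A×¬B : {A B : Set} → Dec A → ¬ (A → B) → A × ¬ B
¬[A→B]⇒A×¬B A? ¬[A→B] =
  decidable-stable A? (λ ¬a → ¬[A→B] (λ a → contradiction a ¬a)) , (λ b → ¬[A→B] (λ _ → b))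

module _ {n : ℕ} where

  subset : {P : Fin n → Set} → (∀ x → Dec (P x)) → Subset n
  subset P? = tabulate (λ x → does (P? x))

  ∈subset⁺ : {P : Fin n → Set} (P? : ∀ x → Dec (P x)) {x : Fin n} → P x → x ∈ subset P?
  ∈subset⁺ P? {x} p = lookup⇒[]= x _ (trans (lookup∘tabulate _ x) (dec-true (P? x) p))

  ∈subset⁻ : {P : Fin n → Set} (P? : ∀ x → Dec (P x)) {x : Fin n} → x ∈ subset P? → P x
  ∈subset⁻ P? {x} x∈ with P? x | trans (sym (lookup∘tabulate _ x)) ([]=⇒lookup x∈)
  ... | yes p | _ = p
  ... | no _  | ()

  ⊆∧≢⇒⊂ : {p q : Subset n} → p ⊆ q → p ≢ q → p ⊂ q
  ⊆∧≢⇒⊂ {p} {q} p⊆q p≢q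
    with ¬∀⟶∃¬ n _ (λ x → x ∈? q →-dec x ∈? p) (λ q⊆p → p≢q (⊆-antisym p⊆q (q⊆p _)))
  ... | x , x∈q↛x∈p = p⊆q , x , ¬[A→B]⇒A×¬B (x ∈? q) x∈q↛x∈p

  _≟ₛ_ : (p q : Subset n) → Dec (p ≡ q)
  _≟ₛ_ = ≡-dec Bool._≟_

  least∈ : {p : Subset n} {x : Fin n} → x ∈ p → ∃ λ r → r ∈ p × (∀ {y} → y ∈ p → r ≤ᶠ y)
  least∈ {p} {x} x∈p with ¬∀⟶∃¬-smallest n (_∉ p) (λ y → ¬? (y ∈? p)) (λ all∉p → all∉p x x∈p)
  ... | r , ¬r∉p , below-r∉p = r , decidable-stable (r ∈? p) ¬r∉p , least
    where
    least : ∀ {y} → y ∈ p → r ≤ᶠ y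
    least {y} y∈p with r ≤ᶠ? y
    ... | yes r≤y = r≤y
    ... | no  r≰y = contradiction (subst (_∈ p) (sym inject-j≡y) y∈p) (below-r∉p j)
      where
      y<r : toℕ y < toℕ r
      y<r = ℕ.≰⇒> r≰y
      j : Fin (toℕ r)
      j = fromℕ< y<r
      inject-j≡y : inject j ≡ y
      inject-j≡y = toℕ-injective (trans (toℕ-inject j) (toℕ-fromℕ< y<r))

  ∈⋂⁺ : {S : List (Subset n)} {x : Fin n} → All (x ∈_) S → x ∈ ⋂ S
  ∈⋂⁺ []           = ∈⊤
  ∈⋂⁺ (x∈p ∷ x∈ps) = x∈p∩q⁺ (x∈p , ∈⋂⁺ x∈ps)

  ∈⋂⁻ : (S : List (Subset n)) {x : Fin n} → x ∈ ⋂ S → All (x ∈_) S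
  ∈⋂⁻ []      _   = []
  ∈⋂⁻ (p ∷ S) x∈ = proj₁ (x∈p∩q⁻ p (⋂ S) x∈) ∷ ∈⋂⁻ S (proj₂ (x∈p∩q⁻ p (⋂ S) x∈))

x∈p─q⇒x∉q : ∀ {n} {p q : Subset n} {x : Fin n} → x ∈ p ─ q → x ∉ q
x∈p─q⇒x∉q {p = true ∷ _} {false ∷ _} here ()
x∈p─q⇒x∉q {p = _ ∷ _} {_ ∷ _} (there x∈p─q) (there x∈q) = x∈p─q⇒x∉q x∈p─q x∈q

restrict : ∀ {n} (c : Subset n) → Subset n → Subset ∣ c ∣
restrict []          []      = []
restrict (true  ∷ c) (b ∷ p) = b ∷ restrict c p
restrict (false ∷ c) (_ ∷ p) = restrict c p

extend : ∀ {n} (c : Subset n) → Subset ∣ c ∣ → Subset n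
extend []          _       = []
extend (true  ∷ c) (b ∷ y) = b ∷ extend c y
extend (false ∷ c) y       = false ∷ extend c y

restrict-extend : ∀ {n} (c : Subset n) y → restrict c (extend c y) ≡ y
restrict-extend []          []      = refl
restrict-extend (true  ∷ c) (b ∷ y) = cong (b ∷_) (restrict-extend c y)
restrict-extend (false ∷ c) y       = restrict-extend c y

extend-restrict : ∀ {n} (c p : Subset n) → extend c (restrict c p) ≡ c ∩ p
extend-restrict []          []      = refl
extend-restrict (true  ∷ c) (b ∷ p) = cong (b ∷_) (extend-restrict c p)
extend-restrict (false ∷ c) (_ ∷ p) = cong (false ∷_) (extend-restrict c p)

extend⊆ : ∀ {n} (c : Subset n) y → extend c y ⊆ c
extend⊆ (true  ∷ c) (b ∷ y) here       = here
extend⊆ (true  ∷ c) (b ∷ y) (there x∈) = there (extend⊆ c y x∈)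
extend⊆ (false ∷ c) y       (there x∈) = there (extend⊆ c y x∈)

restrict-cong : ∀ {n} (c : Subset n) {p q} → c ∩ p ≡ c ∩ q → restrict c p ≡ restrict c q
restrict-cong []          {[]}    {[]}     _  = refl
restrict-cong (true  ∷ c) {b ∷ p} {b′ ∷ q} eq with ∷-injective eq
... | refl , eq′ = cong (b ∷_) (restrict-cong c eq′)
restrict-cong (false ∷ c) {_ ∷ p} {_ ∷ q}  eq = restrict-cong c (∷-injectiveʳ eq)

restrict-mono : ∀ {n} (c : Subset n) {p q} → p ⊆ q → restrict c p ⊆ restrict c q
restrict-mono (true  ∷ c) {_ ∷ p} {_ ∷ q} p⊆q here with p⊆q here
... | here = here
restrict-mono (true  ∷ c) {_ ∷ p} {_ ∷ q} p⊆q (there x∈) = there (restrict-mono c (drop-∷-⊆ p⊆q) x∈)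
restrict-mono (false ∷ c) {_ ∷ p} {_ ∷ q} p⊆q x∈         = restrict-mono c (drop-∷-⊆ p⊆q) x∈

extend-mono : ∀ {n} (c : Subset n) {y z} → y ⊆ z → extend c y ⊆ extend c z
extend-mono (true  ∷ c) {_ ∷ y} {_ ∷ z} y⊆z here with y⊆z here
... | here = here
extend-mono (true  ∷ c) {_ ∷ y} {_ ∷ z} y⊆z (there x∈) = there (extend-mono c (drop-∷-⊆ y⊆z) x∈)
extend-mono (false ∷ c) y⊆z (there x∈) = there (extend-mono c y⊆z x∈)

χ : {P : Set} → Dec P → ℕ
χ P? = if does P? then 1 else 0

χ-yes : {P : Set} (P? : Dec P) → P → χ P? ≡ 1
χ-yes P? p = cong (λ b → if b then 1 else 0) (dec-true P? p)

χ-no : {P : Set} (P? : Dec P) → ¬ P → χ P? ≡ 0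
χ-no P? ¬p = cong (λ b → if b then 1 else 0) (dec-false P? ¬p)

χ-cong : {P Q : Set} (P? : Dec P) (Q? : Dec Q) → P ⇔ Q → χ P? ≡ χ Q?
χ-cong P? Q? P⇔Q = cong (λ b → if b then 1 else 0) (does-⇔ P⇔Q P? Q?)

χ-mono : {P Q : Set} (P? : Dec P) (Q? : Dec Q) → (P → Q) → χ P? ≤ χ Q?
χ-mono (no _)  _       _   = z≤n
χ-mono (yes _) (yes _) _   = ℕ.≤-refl
χ-mono (yes p) (no ¬q) P⇒Q = contradiction (P⇒Q p) ¬q

∣p∣≡∑χ∈ : ∀ {n} (p : Subset n) → ∣ p ∣ ≡ ∑[ x < n ] χ (x ∈? p)
∣p∣≡∑χ∈ []          = refl
∣p∣≡∑χ∈ (true  ∷ p) = cong suc (∣p∣≡∑χ∈ p)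
∣p∣≡∑χ∈ (false ∷ p) = ∣p∣≡∑χ∈ p

∑-mono : ∀ {n} {f g : Fin n → ℕ} → (∀ i → f i ≤ g i) → sum f ≤ sum g
∑-mono {zero}  _   = z≤n
∑-mono {suc n} f≤g = ℕ.+-mono-≤ (f≤g zero) (∑-mono (f≤g ∘ suc))

∑-zero : ∀ {n} {f : Fin n → ℕ} → (∀ i → f i ≡ 0) → sum f ≡ 0
∑-zero {n} f≡0 = trans (sum-cong-≗ f≡0) (sum-replicate-zero n)

∑-point : ∀ {n} (j : Fin n) k → ∑[ i < n ] (χ (i ≟ j) * k) ≡ k
∑-point {suc n} j k = begin
  ∑[ i < suc n ] (χ (i ≟ j) * k)                       ≡⟨ sum-remove {i = j} (λ i → χ (i ≟ j) * k) ⟩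
  χ (j ≟ j) * k + ∑[ i < n ] (χ (punchIn j i ≟ j) * k) ≡⟨ cong₂ _+_ (cong (_* k) (χ-yes (j ≟ j) refl)) (∑-zero off-j) ⟩
  1 * k + 0                                            ≡⟨ ℕ.+-identityʳ (1 * k) ⟩
  1 * k                                                ≡⟨ ℕ.*-identityˡ k ⟩
  k                                                    ∎
  where
  open ≡-Reasoning
  off-j : ∀ i → χ (punchIn j i ≟ j) * k ≡ 0
  off-j i = cong (_* k) (χ-no (punchIn j i ≟ j) (punchInᵢ≢i j i))

∑-bijection : ∀ {n} (f : Fin n → ℕ) (σ σ⁻¹ : Fin n → Fin n) →
              (∀ x → σ (σ⁻¹ x) ≡ x) → (∀ x → σ⁻¹ (σ x) ≡ x) → sum f ≡ sum (f ∘ σ)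
∑-bijection f σ σ⁻¹ inv₁ inv₂ = sum-permute f (permutation σ σ⁻¹ inv₁ inv₂)

meet-unique : ∀ {n} {L : Subset n → Set} {S X Y} → IsMeetIn L S X → IsMeetIn L S Y → X ≡ Y
meet-unique (LX , X⊆S , X-glb) (LY , Y⊆S , Y-glb) = ⊆-antisym (Y-glb _ LX X⊆S) (X-glb _ LY Y⊆S)

module _ {n : ℕ} (L : Subset n → Set) {C : Subset n} (L⊆C : ∀ W → L W → W ⊆ C) (L-C : L C) where

  coatom∈Int : ∀ {c} → IsCoatom L C c → InInt L C c
  coatom∈Int co = (_ ∷ []) , (co ∷ []) , proj₁ co , (⊆-refl ∷ []) , λ { _ _ (W⊆c ∷ []) → W⊆c }

  top∈Int : InInt L C C
  top∈Int = [] , [] , L-C , [] , λ W LW _ → L⊆C W LW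

  private
    Elem : Set
    Elem = Σ (Subset n) (InInt L C)

    L-elem : (a : Elem) → L (proj₁ a)
    L-elem (_ , _ , _ , La , _) = La

    topᴱ : Elem
    topᴱ = C , top∈Int

    coatomᴱ : ∀ {c} → IsCoatom L C c → Elem
    coatomᴱ co = _ , coatom∈Int co

    module BooleanIso {k : ℕ} (f : Elem → Subset k) (g : Subset k → Elem) (fg : ∀ y → f (g y) ≡ y)
                      (f-ord : ∀ a b → (proj₁ a ⊆ proj₁ b) ⇔ (f a ⊆ f b)) where

      mono : ∀ a b → proj₁ a ⊆ proj₁ b → f a ⊆ f b
      mono a b = Equivalence.to (f-ord a b)

      reflect : ∀ a b → f a ⊆ f b → proj₁ a ⊆ proj₁ b
      reflect a b = Equivalence.from (f-ord a b)

      ⊆fg : ∀ y → y ⊆ f (g y)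
      ⊆fg y = ⊆-reflexive (sym (fg y))

      fg⊆ : ∀ y → f (g y) ⊆ y
      fg⊆ y = ⊆-reflexive (fg y)

      ⊤⊆f-top : ⊤ ⊆ f topᴱ
      ⊤⊆f-top x∈⊤ = mono (g ⊤) topᴱ (L⊆C _ (L-elem (g ⊤))) (⊆fg ⊤ x∈⊤)

      -- An order isomorphism onto Subset k sends a coatom to the complement of a point.
      coatom-image : ∀ {c} (co : IsCoatom L C c) {i} → i ∉ f (coatomᴱ co) → ∀ {j} → j ≢ i → j ∈ f (coatomᴱ co)
      coatom-image {c} co@(_ , _ , _ , between) {i} i∉fc {j} j≢i =
        [ (λ w≡c → contradiction (mono w (coatomᴱ co) (⊆-reflexive w≡c) i∈fw) i∉fc)
        , (λ w≡C → [ id , (λ j∈⁅i⁆ → contradiction (x∈⁅y⁆⇒x≡y i j∈⁅i⁆) j≢i) ]′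
                     (x∈p∪q⁻ _ _ (fg⊆ _ (mono topᴱ w (⊆-reflexive (sym w≡C)) (⊤⊆f-top ∈⊤)))))
        ]′ (between (proj₁ w) (L-elem w) c⊆w (L⊆C _ (L-elem w)))
        where
        w : Elem
        w = g (f (coatomᴱ co) ∪ ⁅ i ⁆)
        c⊆w : c ⊆ proj₁ w
        c⊆w = reflect (coatomᴱ co) w (λ x∈ → ⊆fg _ (x∈p∪q⁺ (inj₁ x∈)))
        i∈fw : i ∈ f w
        i∈fw = ⊆fg _ (x∈p∪q⁺ (inj₂ (x∈⁅x⁆ i)))

      ⊆coatom-missing : ∀ a {c} (co : IsCoatom L C c) {i} → i ∉ f a → i ∉ f (coatomᴱ co) → f a ⊆ f (coatomᴱ co)
      ⊆coatom-missing a co {i} i∉fa i∉fc {j} j∈fa with j ≟ i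
      ... | yes refl = contradiction j∈fa i∉fa
      ... | no j≢i   = coatom-image co i∉fc j≢i

      coatoms-missing-same-point : ∀ {c c′} (co : IsCoatom L C c) (co′ : IsCoatom L C c′) {i} →
                                   i ∉ f (coatomᴱ co) → i ∉ f (coatomᴱ co′) → c ≡ c′
      coatoms-missing-same-point co co′ i∉fc i∉fc′ =
        ⊆-antisym (reflect _ _ (⊆coatom-missing _ co′ i∉fc i∉fc′))
                  (reflect _ _ (⊆coatom-missing _ co i∉fc′ i∉fc))

      -- If i ∉ f M then every other coatom contains i, so g (f X ∪ ⁅ i ⁆) lies below all of S,
      -- hence below X ⊆ M.
      coatom⊇meet⇒full : ∀ {M X} S (coM : IsCoatom L C M) → All (λ c → IsCoatom L C c × c ≢ M) S →
                         IsMeetIn L S X → X ⊆ M → ⊤ ⊆ f (coatomᴱ coM)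
      coatom⊇meet⇒full {M} {X} S coM coS meetX@(_ , X⊆S , X-glb) X⊆M {i} _ with i ∈? f (coatomᴱ coM)
      ... | yes i∈fM = i∈fM
      ... | no  i∉fM = mono Xᴱ (coatomᴱ coM) X⊆M (mono w Xᴱ w⊆X (⊆fg _ (x∈p∪q⁺ (inj₂ (x∈⁅x⁆ i)))))
        where
        Xᴱ : Elem
        Xᴱ = X , S , All.map proj₁ coS , meetX
        w : Elem
        w = g (f Xᴱ ∪ ⁅ i ⁆)
        i∈f-other : ∀ {c} (co : IsCoatom L C c) → c ≢ M → i ∈ f (coatomᴱ co)
        i∈f-other co c≢M with i ∈? f (coatomᴱ co)
        ... | yes i∈fc = i∈fc
        ... | no  i∉fc = contradiction (coatoms-missing-same-point co coM i∉fc i∉fM) c≢M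
        w⊆other : ∀ {c} → (IsCoatom L C c × c ≢ M) × X ⊆ c → proj₁ w ⊆ c
        w⊆other ((co , c≢M) , X⊆c) = reflect w (coatomᴱ co) λ j∈fw →
          [ mono Xᴱ (coatomᴱ co) X⊆c
          , (λ j∈⁅i⁆ → subst (_∈ f (coatomᴱ co)) (sym (x∈⁅y⁆⇒x≡y i j∈⁅i⁆)) (i∈f-other co c≢M))
          ]′ (x∈p∪q⁻ _ _ (fg⊆ _ j∈fw))
        w⊆X : proj₁ w ⊆ X
        w⊆X = X-glb (proj₁ w) (L-elem w) (All.zipWith w⊆other (coS , X⊆S))

  coatom⊇meet⇒¬Boolean : ∀ {M X} S → IsCoatom L C M → All (λ c → IsCoatom L C c × c ≢ M) S →
                         IsMeetIn L S X → X ⊆ M → ¬ IsoToBoolean (InInt L C)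
  coatom⊇meet⇒¬Boolean S coM@(_ , M⊆C , M≢C , _) coS meetX X⊆M (_ , f , g , _ , fg , f-ord) =
    M≢C (⊆-antisym M⊆C (reflect topᴱ (coatomᴱ coM) (λ _ → coatom⊇meet⇒full S coM coS meetX X⊆M ∈⊤)))
    where open BooleanIso f g fg f-ord

module _ {n : ℕ} (G : FinGroup n) where
  open FinGroup G
  open IsGroup isGroup using (assoc; identityˡ; identityʳ; inverseˡ; inverseʳ)

  private
    group : Group 0ℓ 0ℓ
    group = record { isGroup = isGroup }

  open GroupProperties group using (⁻¹-involutive; ⁻¹-anti-homo-∙; ε⁻¹≈ε)

  conj : Fin n → Fin n → Fin n
  conj a b = a ∙ b ∙ a ⁻¹

  module _ where
    open ≡-Reasoning

    x∙y∙y⁻¹≡x : ∀ x y → x ∙ y ∙ y ⁻¹ ≡ x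
    x∙y∙y⁻¹≡x x y = begin
      x ∙ y ∙ y ⁻¹   ≡⟨ assoc x y (y ⁻¹) ⟩
      x ∙ (y ∙ y ⁻¹) ≡⟨ cong (x ∙_) (inverseʳ y) ⟩
      x ∙ ε          ≡⟨ identityʳ x ⟩
      x              ∎

    x∙y⁻¹∙y≡x : ∀ x y → x ∙ y ⁻¹ ∙ y ≡ x
    x∙y⁻¹∙y≡x x y = begin
      x ∙ y ⁻¹ ∙ y   ≡⟨ assoc x (y ⁻¹) y ⟩
      x ∙ (y ⁻¹ ∙ y) ≡⟨ cong (x ∙_) (inverseˡ y) ⟩
      x ∙ ε          ≡⟨ identityʳ x ⟩
      x              ∎

    conj-∙ : ∀ a b x → conj a (conj b x) ≡ conj (a ∙ b) x
    conj-∙ a b x = begin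
      a ∙ (b ∙ x ∙ b ⁻¹) ∙ a ⁻¹     ≡⟨ cong (_∙ a ⁻¹) (assoc a (b ∙ x) (b ⁻¹)) ⟨
      a ∙ (b ∙ x) ∙ b ⁻¹ ∙ a ⁻¹     ≡⟨ assoc (a ∙ (b ∙ x)) (b ⁻¹) (a ⁻¹) ⟩
      a ∙ (b ∙ x) ∙ (b ⁻¹ ∙ a ⁻¹)   ≡⟨ cong₂ _∙_ (assoc a b x) (⁻¹-anti-homo-∙ a b) ⟨
      a ∙ b ∙ x ∙ (a ∙ b) ⁻¹        ∎

    conj-identity : ∀ x → conj ε x ≡ x
    conj-identity x = begin
      ε ∙ x ∙ ε ⁻¹ ≡⟨ cong₂ _∙_ (identityˡ x) ε⁻¹≈ε ⟩
      x ∙ ε        ≡⟨ identityʳ x ⟩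
      x            ∎

    conj-inverseˡ : ∀ a x → conj (a ⁻¹) (conj a x) ≡ x
    conj-inverseˡ a x = begin
      conj (a ⁻¹) (conj a x) ≡⟨ conj-∙ (a ⁻¹) a x ⟩
      conj (a ⁻¹ ∙ a) x      ≡⟨ cong (λ b → conj b x) (inverseˡ a) ⟩
      conj ε x               ≡⟨ conj-identity x ⟩
      x                      ∎

    conj-inverseʳ : ∀ a x → conj a (conj (a ⁻¹) x) ≡ x
    conj-inverseʳ a x = begin
      conj a (conj (a ⁻¹) x) ≡⟨ conj-∙ a (a ⁻¹) x ⟩
      conj (a ∙ a ⁻¹) x      ≡⟨ cong (λ b → conj b x) (inverseʳ a) ⟩
      conj ε x               ≡⟨ conj-identity x ⟩
      x                      ∎

    conj-ε : ∀ a → conj a ε ≡ ε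
    conj-ε a = trans (cong (_∙ a ⁻¹) (identityʳ a)) (inverseʳ a)

    conj-homo-∙ : ∀ a x y → conj a (x ∙ y) ≡ conj a x ∙ conj a y
    conj-homo-∙ a x y = begin
      a ∙ (x ∙ y) ∙ a ⁻¹                    ≡⟨ cong (_∙ a ⁻¹) (assoc a x y) ⟨
      a ∙ x ∙ y ∙ a ⁻¹                      ≡⟨ cong (λ b → b ∙ y ∙ a ⁻¹) (x∙y⁻¹∙y≡x (a ∙ x) a) ⟨
      a ∙ x ∙ a ⁻¹ ∙ a ∙ y ∙ a ⁻¹           ≡⟨ cong (_∙ a ⁻¹) (assoc (a ∙ x ∙ a ⁻¹) a y) ⟩
      a ∙ x ∙ a ⁻¹ ∙ (a ∙ y) ∙ a ⁻¹         ≡⟨ assoc (a ∙ x ∙ a ⁻¹) (a ∙ y) (a ⁻¹) ⟩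
      a ∙ x ∙ a ⁻¹ ∙ (a ∙ y ∙ a ⁻¹)         ∎

    conj-homo-⁻¹ : ∀ a x → conj a (x ⁻¹) ≡ conj a x ⁻¹
    conj-homo-⁻¹ a x = sym (begin
      (a ∙ x ∙ a ⁻¹) ⁻¹        ≡⟨ ⁻¹-anti-homo-∙ (a ∙ x) (a ⁻¹) ⟩
      a ⁻¹ ⁻¹ ∙ (a ∙ x) ⁻¹     ≡⟨ cong₂ _∙_ (⁻¹-involutive a) (⁻¹-anti-homo-∙ a x) ⟩
      a ∙ (x ⁻¹ ∙ a ⁻¹)        ≡⟨ assoc a (x ⁻¹) (a ⁻¹) ⟨
      a ∙ x ⁻¹ ∙ a ⁻¹          ∎)

    conj-⁻¹-self : ∀ x → conj (x ⁻¹) x ≡ x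
    conj-⁻¹-self x = begin
      x ⁻¹ ∙ x ∙ x ⁻¹ ⁻¹ ≡⟨ cong (_∙ x ⁻¹ ⁻¹) (inverseˡ x) ⟩
      ε ∙ x ⁻¹ ⁻¹        ≡⟨ identityˡ (x ⁻¹ ⁻¹) ⟩
      x ⁻¹ ⁻¹            ≡⟨ ⁻¹-involutive x ⟩
      x                  ∎

    ⁻¹∙x∙≡conj⁻¹ : ∀ a x → a ⁻¹ ∙ x ∙ a ≡ conj (a ⁻¹) x
    ⁻¹∙x∙≡conj⁻¹ a x = cong (a ⁻¹ ∙ x ∙_) (sym (⁻¹-involutive a))

  Invariant : Subset n → Subset n → Set
  Invariant K Q = ∀ {k} → k ∈ K → ∀ {q} → q ∈ Q → conj k q ∈ Q

  subrack⇒conj-closed : ∀ {Q} → IsSubrack G Q → ∀ {a b} → a ∈ Q → b ∈ Q → conj a b ∈ Q × conj (a ⁻¹) b ∈ Q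
  subrack⇒conj-closed {Q} Q-rack {a} {b} a∈Q b∈Q =
    proj₁ (Q-rack a b a∈Q b∈Q) , subst (_∈ Q) (⁻¹∙x∙≡conj⁻¹ a b) (proj₂ (Q-rack a b a∈Q b∈Q))

  invariant⇒subrack : ∀ {K Q} → IsSubgroup G K → Q ⊆ K → Invariant K Q → IsSubrack G Q
  invariant⇒subrack {Q = Q} (_ , _ , K-⁻¹) Q⊆K Q-inv a b a∈Q b∈Q =
    Q-inv (Q⊆K a∈Q) b∈Q , subst (_∈ Q) (sym (⁻¹∙x∙≡conj⁻¹ a b)) (Q-inv (K-⁻¹ a (Q⊆K a∈Q)) b∈Q)

  ⊤-isSubgroup : IsSubgroup G ⊤
  ⊤-isSubgroup = ∈⊤ , (λ _ _ _ _ → ∈⊤) , (λ _ _ → ∈⊤)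

  subgroup-invariant : ∀ {H} → IsSubgroup G H → Invariant H H
  subgroup-invariant (_ , H-∙ , H-⁻¹) {a} a∈H b∈H = H-∙ _ _ (H-∙ _ _ a∈H b∈H) (H-⁻¹ a a∈H)

  subgroup⇒subrack : ∀ {H} → IsSubgroup G H → IsSubrack G H
  subgroup⇒subrack H-grp = invariant⇒subrack H-grp ⊆-refl (subgroup-invariant H-grp)

  ∩-isSubgroup : ∀ {A B} → IsSubgroup G A → IsSubgroup G B → IsSubgroup G (A ∩ B)
  ∩-isSubgroup {A} {B} (A-ε , A-∙ , A-⁻¹) (B-ε , B-∙ , B-⁻¹) =
      x∈p∩q⁺ (A-ε , B-ε)
    , (λ a b a∈ b∈ → x∈p∩q⁺ ( A-∙ a b (p∩q⊆p A B a∈) (p∩q⊆p A B b∈)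
                            , B-∙ a b (p∩q⊆q A B a∈) (p∩q⊆q A B b∈)))
    , (λ a a∈ → x∈p∩q⁺ (A-⁻¹ a (p∩q⊆p A B a∈) , B-⁻¹ a (p∩q⊆q A B a∈)))

  ∩-isSubrack : ∀ {A B} → IsSubrack G A → IsSubrack G B → IsSubrack G (A ∩ B)
  ∩-isSubrack {A} {B} A-rack B-rack a b a∈ b∈ =
    let a∈A , a∈B = x∈p∩q⁻ A B a∈
        b∈A , b∈B = x∈p∩q⁻ A B b∈
        r₁ , r₂   = A-rack a b a∈A b∈A
        s₁ , s₂   = B-rack a b a∈B b∈B
    in x∈p∩q⁺ (r₁ , s₁) , x∈p∩q⁺ (r₂ , s₂)

  ⋂-isSubrack : ∀ {S} → All (IsSubrack G) S → IsSubrack G (⋂ S)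
  ⋂-isSubrack []                  _ _ _ _ = ∈⊤ , ∈⊤
  ⋂-isSubrack (X-rack ∷ S-racks) = ∩-isSubrack X-rack (⋂-isSubrack S-racks)

  ⋂∩-isMeetIn : ∀ {C} → IsSubrack G C → ∀ S → All (InInterval G ⊥ C) S →
                IsMeetIn (InInterval G ⊥ C) S (⋂ S ∩ C)
  ⋂∩-isMeetIn {C} C-rack S S-L =
      (∩-isSubrack (⋂-isSubrack (All.map proj₁ S-L)) C-rack , ⊥⊆ , p∩q⊆q (⋂ S) C)
    , All.tabulate (λ X∈S x∈ → All.lookup (∈⋂⁻ S (p∩q⊆p (⋂ S) C x∈)) X∈S)
    , λ W (_ , _ , W⊆C) W⊆S x∈W → x∈p∩q⁺ (∈⋂⁺ (All.map (λ W⊆X → W⊆X x∈W) W⊆S) , W⊆C x∈W)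

  private
    closure? : ∀ R x → Dec (∃ λ y → ∃ λ g → y ∈ R × x ≡ conj g y)
    closure? R x = any? λ y → any? λ g → (y ∈? R) ×-dec (x ≟ conj g y)

  ∈closure⁺ : ∀ {R y} g → y ∈ R → conj g y ∈ closure G R
  ∈closure⁺ {R} {y} g y∈R = ∈subset⁺ (closure? R) (y , g , y∈R , refl)

  ∈closure⁻ : ∀ {R x} → x ∈ closure G R → ∃ λ y → ∃ λ g → y ∈ R × x ≡ conj g y
  ∈closure⁻ {R} = ∈subset⁻ (closure? R)

  ⊆closure : ∀ {R} → R ⊆ closure G R
  ⊆closure {R} {y} y∈R = subst (_∈ closure G R) (conj-identity y) (∈closure⁺ ε y∈R)

  closure-invariant : ∀ R → Invariant ⊤ (closure G R)
  closure-invariant R {a} _ x∈ with ∈closure⁻ x∈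
  ... | y , g , y∈R , refl = subst (_∈ closure G R) (sym (conj-∙ a g y)) (∈closure⁺ (a ∙ g) y∈R)

  closure-least : ∀ {R Q} → Invariant ⊤ Q → R ⊆ Q → closure G R ⊆ Q
  closure-least Q-inv R⊆Q x∈ with ∈closure⁻ x∈
  ... | y , g , y∈R , refl = Q-inv ∈⊤ (R⊆Q y∈R)

  invariant⇒closed : ∀ {Q} → Invariant ⊤ Q → IsClosed G Q
  invariant⇒closed Q-inv = ⊆-antisym (closure-least Q-inv ⊆-refl) ⊆closure

  Normalises : Fin n → Subset n → Set
  Normalises g W = ∀ w → w ∈ W → conj g w ∈ W × conj (g ⁻¹) w ∈ W

  normalises? : ∀ W g → Dec (Normalises g W)
  normalises? W g = all? λ w → w ∈? W →-dec (conj g w ∈? W ×-dec conj (g ⁻¹) w ∈? W)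

  normaliser : Subset n → Subset n
  normaliser W = subset (normalises? W)

  ∈normaliser⁺ : ∀ {W g} → Normalises g W → g ∈ normaliser W
  ∈normaliser⁺ {W} = ∈subset⁺ (normalises? W)

  ∈normaliser⁻ : ∀ {W g} → g ∈ normaliser W → Normalises g W
  ∈normaliser⁻ {W} = ∈subset⁻ (normalises? W)

  normaliser-isSubgroup : ∀ W → IsSubgroup G (normaliser W)
  normaliser-isSubgroup W = ∈normaliser⁺ ε-normalises , ∙-normalises , ⁻¹-normalises
    where
    ε-normalises : Normalises ε W
    ε-normalises w w∈W =
      subst (_∈ W) (sym (conj-identity w)) w∈W ,
      subst (_∈ W) (sym (trans (cong (λ e → conj e w) ε⁻¹≈ε) (conj-identity w))) w∈W
    ∙-normalises : ∀ a b → a ∈ normaliser W → b ∈ normaliser W → a ∙ b ∈ normaliser W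
    ∙-normalises a b a∈N b∈N = ∈normaliser⁺ λ w w∈W →
        subst (_∈ W) (conj-∙ a b w) (proj₁ (∈normaliser⁻ a∈N _ (proj₁ (∈normaliser⁻ b∈N w w∈W))))
      , subst (_∈ W) (trans (conj-∙ (b ⁻¹) (a ⁻¹) w) (cong (λ e → conj e w) (sym (⁻¹-anti-homo-∙ a b))))
              (proj₂ (∈normaliser⁻ b∈N _ (proj₂ (∈normaliser⁻ a∈N w w∈W))))
    ⁻¹-normalises : ∀ a → a ∈ normaliser W → a ⁻¹ ∈ normaliser W
    ⁻¹-normalises a a∈N = ∈normaliser⁺ λ w w∈W →
        proj₂ (∈normaliser⁻ a∈N w w∈W)
      , subst (_∈ W) (cong (λ e → conj e w) (sym (⁻¹-involutive a))) (proj₁ (∈normaliser⁻ a∈N w w∈W))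

  normaliser-invariant : ∀ W → Invariant (normaliser W) W
  normaliser-invariant W g∈N w∈W = proj₁ (∈normaliser⁻ g∈N _ w∈W)

  subrack⊆normaliser : ∀ {W} → IsSubrack G W → W ⊆ normaliser W
  subrack⊆normaliser W-rack a∈W = ∈normaliser⁺ λ w w∈W → subrack⇒conj-closed W-rack a∈W w∈W

  maximal⊂subgroup⇒⊤ : ∀ {M H} → IsMaximalSubgroup G M → IsSubgroup G H → M ⊂ H → ⊤ ⊆ H
  maximal⊂subgroup⇒⊤ (_ , _ , maximal) H-grp (M⊆H , x , x∈H , x∉M) with maximal _ H-grp M⊆H
  ... | inj₁ refl = contradiction x∈H x∉M
  ... | inj₂ refl = id

  -- The normaliser of such a Q is a subgroup strictly containing M, hence all of G.
  maximal⊂subrack⇒invariant : ∀ {M Q} → IsMaximalSubgroup G M → IsSubrack G Q → M ⊂ Q → Invariant ⊤ Q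
  maximal⊂subrack⇒invariant {Q = Q} M-max Q-rack (M⊆Q , x , x∈Q , x∉M) _ =
    normaliser-invariant Q (maximal⊂subgroup⇒⊤ M-max (normaliser-isSubgroup Q) M⊂N ∈⊤)
    where
    M⊂N : _ ⊂ normaliser Q
    M⊂N = (λ m∈M → subrack⊆normaliser Q-rack (M⊆Q m∈M)) , x , subrack⊆normaliser Q-rack x∈Q , x∉M

  conj-preimage : Fin n → Subset n → Subset n
  conj-preimage a H = subset (λ h → conj a h ∈? H)

  ∈conj-preimage⁺ : ∀ {a H h} → conj a h ∈ H → h ∈ conj-preimage a H
  ∈conj-preimage⁺ {a} {H} = ∈subset⁺ (λ h → conj a h ∈? H)

  ∈conj-preimage⁻ : ∀ {a H h} → h ∈ conj-preimage a H → conj a h ∈ H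
  ∈conj-preimage⁻ {a} {H} = ∈subset⁻ (λ h → conj a h ∈? H)

  conj-preimage-isSubgroup : ∀ a {H} → IsSubgroup G H → IsSubgroup G (conj-preimage a H)
  conj-preimage-isSubgroup a {H} (H-ε , H-∙ , H-⁻¹) =
      ∈conj-preimage⁺ (subst (_∈ H) (sym (conj-ε a)) H-ε)
    , (λ x y x∈ y∈ → ∈conj-preimage⁺ (subst (_∈ H) (sym (conj-homo-∙ a x y))
                                       (H-∙ _ _ (∈conj-preimage⁻ x∈) (∈conj-preimage⁻ y∈))))
    , (λ x x∈ → ∈conj-preimage⁺ (subst (_∈ H) (sym (conj-homo-⁻¹ a x)) (H-⁻¹ _ (∈conj-preimage⁻ x∈))))

  conjugate : Fin n → Subset n → Subset n
  conjugate g H = conj-preimage (g ⁻¹) H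

  ∈conjugate⁺ : ∀ g {H h} → h ∈ H → conj g h ∈ conjugate g H
  ∈conjugate⁺ g {H} {h} h∈H = ∈conj-preimage⁺ (subst (_∈ H) (sym (conj-inverseˡ g h)) h∈H)

  conjugate-identity : ∀ H → conjugate ε H ≡ H
  conjugate-identity H = ⊆-antisym (λ h∈ → subst (_∈ H) (conj-ε⁻¹ _) (∈conj-preimage⁻ h∈))
                                   (λ h∈H → ∈conj-preimage⁺ (subst (_∈ H) (sym (conj-ε⁻¹ _)) h∈H))
    where
    conj-ε⁻¹ : ∀ h → conj (ε ⁻¹) h ≡ h
    conj-ε⁻¹ h = trans (cong (λ e → conj e h) ε⁻¹≈ε) (conj-identity h)

  conjugate-isMaximal : ∀ g {M} → IsMaximalSubgroup G M → IsMaximalSubgroup G (conjugate g M)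
  conjugate-isMaximal g {M} (M-grp , M≢⊤ , maximal) =
    conj-preimage-isSubgroup (g ⁻¹) M-grp , gMg⁻¹≢⊤ , gMg⁻¹-maximal
    where
    gMg⁻¹≢⊤ : conjugate g M ≢ ⊤
    gMg⁻¹≢⊤ eq = M≢⊤ (⊆-antisym (λ _ → ∈⊤) λ {z} _ →
      subst (_∈ M) (conj-inverseˡ g z) (∈conj-preimage⁻ (subst (conj g z ∈_) (sym eq) ∈⊤)))
    gMg⁻¹-maximal : ∀ H → IsSubgroup G H → conjugate g M ⊆ H → H ≡ conjugate g M ⊎ H ≡ ⊤
    gMg⁻¹-maximal H H-grp gMg⁻¹⊆H
      with maximal (conj-preimage g H) (conj-preimage-isSubgroup g H-grp)
                   (λ m∈M → ∈conj-preimage⁺ (gMg⁻¹⊆H (∈conjugate⁺ g m∈M)))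
    ... | inj₁ g⁻¹Hg≡M = inj₁ (⊆-antisym H⊆gMg⁻¹ gMg⁻¹⊆H)
      where
      H⊆gMg⁻¹ : H ⊆ conjugate g M
      H⊆gMg⁻¹ {h} h∈H = ∈conj-preimage⁺ (subst (conj (g ⁻¹) h ∈_) g⁻¹Hg≡M
                          (∈conj-preimage⁺ (subst (_∈ H) (sym (conj-inverseʳ g h)) h∈H)))
    ... | inj₂ g⁻¹Hg≡⊤ = inj₂ (⊆-antisym (λ _ → ∈⊤) λ {h} _ →
      subst (_∈ H) (conj-inverseʳ g h) (∈conj-preimage⁻ (subst (conj (g ⁻¹) h ∈_) (sym g⁻¹Hg≡⊤) ∈⊤)))

  ConjugatesCover : Subset n → Subset n → Set
  ConjugatesCover C S = ∀ {x} → x ∈ C → ∃ λ g → g ∈ C × conj g x ∈ S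

  private
    module PairCount {C S : Subset n} (C-grp : IsSubgroup G C) (S-grp : IsSubgroup G S) (S⊆C : S ⊆ C) where

      c s : ℕ
      c = ∣ C ∣
      s = ∣ S ∣

      pair? : ∀ g x → Dec (g ∈ C × conj g x ∈ S)
      pair? g x = (g ∈? C) ×-dec (conj g x ∈? S)

      pairs : Fin n → Fin n → ℕ
      pairs g x = χ (pair? g x)

      row : ∀ g → ∑[ x < n ] pairs g x ≡ χ (g ∈? C) * s
      row g = row′ (g ∈? C)
        where
        open ≡-Reasoning
        row′ : Dec (g ∈ C) → ∑[ x < n ] pairs g x ≡ χ (g ∈? C) * s
        row′ (no g∉C) =
          trans (∑-zero (λ x → χ-no (pair? g x) (g∉C ∘ proj₁))) (cong (_* s) (sym (χ-no (g ∈? C) g∉C)))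
        row′ (yes g∈C) = begin
          ∑[ x < n ] pairs g x         ≡⟨ sum-cong-≗ (λ x → χ-cong (pair? g x) (conj g x ∈? S) (mk⇔ proj₂ (g∈C ,_))) ⟩
          ∑[ x < n ] χ (conj g x ∈? S) ≡⟨ ∑-bijection (λ x → χ (x ∈? S)) (conj g) (conj (g ⁻¹))
                                                       (conj-inverseʳ g) (conj-inverseˡ g) ⟨
          ∑[ x < n ] χ (x ∈? S)        ≡⟨ ∣p∣≡∑χ∈ S ⟨
          s                            ≡⟨ ℕ.*-identityˡ s ⟨
          1 * s                        ≡⟨ cong (_* s) (χ-yes (g ∈? C) g∈C) ⟨
          χ (g ∈? C) * s               ∎

      ∑pairs : ∑[ g < n ] ∑[ x < n ] pairs g x ≡ c * s
      ∑pairs = begin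
        ∑[ g < n ] ∑[ x < n ] pairs g x ≡⟨ sum-cong-≗ row ⟩
        ∑[ g < n ] (χ (g ∈? C) * s)     ≡⟨ *-distribʳ-sum s (λ g → χ (g ∈? C)) ⟨
        ∑[ g < n ] χ (g ∈? C) * s       ≡⟨ cong (_* s) (∣p∣≡∑χ∈ C) ⟨
        c * s                           ∎
        where open ≡-Reasoning

      column-ε : ∑[ g < n ] pairs g ε ≡ c
      column-ε = begin
        ∑[ g < n ] pairs g ε   ≡⟨ sum-cong-≗ (λ g → χ-cong (pair? g ε) (g ∈? C) (mk⇔ proj₁ (_, ε-conj∈S g))) ⟩
        ∑[ g < n ] χ (g ∈? C)  ≡⟨ ∣p∣≡∑χ∈ C ⟨
        c                      ∎
        where
        open ≡-Reasoning
        ε-conj∈S : ∀ g → conj g ε ∈ S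
        ε-conj∈S g = subst (_∈ S) (sym (conj-ε g)) (proj₁ S-grp)

      column-∈C : ConjugatesCover C S → ∀ {x} → x ∈ C → s ≤ ∑[ g < n ] pairs g x
      column-∈C cover {x} x∈C with cover x∈C
      ... | g₀ , g₀∈C , g₀xg₀⁻¹∈S = begin
        s                            ≡⟨ ∣p∣≡∑χ∈ S ⟩
        ∑[ y < n ] χ (y ∈? S)        ≤⟨ ∑-mono (λ y → χ-mono (y ∈? S) (pair? (y ∙ g₀) x) (coset y)) ⟩
        ∑[ y < n ] pairs (y ∙ g₀) x  ≡⟨ ∑-bijection (λ g → pairs g x) (_∙ g₀) (_∙ g₀ ⁻¹)
                                                     (λ y → x∙y⁻¹∙y≡x y g₀) (λ y → x∙y∙y⁻¹≡x y g₀) ⟨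
        ∑[ g < n ] pairs g x         ∎
        where
        open ℕ.≤-Reasoning
        coset : ∀ y → y ∈ S → y ∙ g₀ ∈ C × conj (y ∙ g₀) x ∈ S
        coset y y∈S = proj₁ (proj₂ C-grp) y g₀ (S⊆C y∈S) g₀∈C
                    , subst (_∈ S) (conj-∙ y g₀ x) (subgroup-invariant S-grp y∈S g₀xg₀⁻¹∈S)

      lower : Fin n → ℕ
      lower x = χ (x ∈? C) * s + χ (x ≟ ε) * (c ∸ s)

      lower≤column : ConjugatesCover C S → ∀ x → lower x ≤ ∑[ g < n ] pairs g x
      lower≤column cover x with x ∈? C | x ≟ ε
      ... | no x∉C  | yes refl = contradiction (proj₁ C-grp) x∉C
      ... | no _    | no _     = z≤n
      ... | yes _   | yes refl = ℕ.≤-reflexive (begin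
        1 * s + 1 * (c ∸ s)  ≡⟨ cong₂ _+_ (ℕ.*-identityˡ s) (ℕ.*-identityˡ (c ∸ s)) ⟩
        s + (c ∸ s)          ≡⟨ ℕ.m+[n∸m]≡n (p⊆q⇒∣p∣≤∣q∣ S⊆C) ⟩
        c                    ≡⟨ column-ε ⟨
        ∑[ g < n ] pairs g ε ∎)
        where open ≡-Reasoning
      ... | yes x∈C | no _     = ℕ.≤-trans (ℕ.≤-reflexive (trans (ℕ.+-identityʳ (1 * s)) (ℕ.*-identityˡ s)))
                                           (column-∈C cover x∈C)

      ∑lower : ∑[ x < n ] lower x ≡ c * s + (c ∸ s)
      ∑lower = begin
        ∑[ x < n ] lower x
          ≡⟨ ∑-distrib-+ (λ x → χ (x ∈? C) * s) (λ x → χ (x ≟ ε) * (c ∸ s)) ⟩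
        ∑[ x < n ] (χ (x ∈? C) * s) + ∑[ x < n ] (χ (x ≟ ε) * (c ∸ s))
          ≡⟨ cong₂ _+_ (sym (*-distribʳ-sum s (λ x → χ (x ∈? C)))) (∑-point ε (c ∸ s)) ⟩
        ∑[ x < n ] χ (x ∈? C) * s + (c ∸ s)
          ≡⟨ cong (λ m → m * s + (c ∸ s)) (∣p∣≡∑χ∈ C) ⟨
        c * s + (c ∸ s)
          ∎
        where open ≡-Reasoning

  -- Count the pairs (g, x) with g ∈ C and conj g x ∈ S: every g ∈ C accounts for |S| of them,
  -- every x ∈ C for at least |S| (the coset S g₀ of a g₀ conjugating x into S), and x = ε for |C|.
  conjugatesCover⇒∣C∣≤∣S∣ : ∀ {C S} → IsSubgroup G C → IsSubgroup G S → S ⊆ C →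
                            ConjugatesCover C S → ∣ C ∣ ≤ ∣ S ∣
  conjugatesCover⇒∣C∣≤∣S∣ C-grp S-grp S⊆C cover =
    ℕ.m∸n≡0⇒m≤n (ℕ.n≤0⇒n≡0 (ℕ.+-cancelˡ-≤ (c * s) (c ∸ s) 0 (begin
      c * s + (c ∸ s)                 ≡⟨ ∑lower ⟨
      ∑[ x < n ] lower x              ≤⟨ ∑-mono (lower≤column cover) ⟩
      ∑[ x < n ] ∑[ g < n ] pairs g x ≡⟨ ∑-comm pairs ⟨
      ∑[ g < n ] ∑[ x < n ] pairs g x ≡⟨ ∑pairs ⟩
      c * s                           ≡⟨ ℕ.+-identityʳ (c * s) ⟨
      c * s + 0                       ∎)))
    where
    open PairCount C-grp S-grp S⊆C
    open ℕ.≤-Reasoning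

  -- Jordan: a finite group is not the union of the conjugates of a proper subgroup.
  conjugatesCover⇒⊆ : ∀ {C S} → IsSubgroup G C → IsSubgroup G S → S ⊆ C → ConjugatesCover C S → C ⊆ S
  conjugatesCover⇒⊆ {C} {S} C-grp S-grp S⊆C cover {x} x∈C with x ∈? S
  ... | yes x∈S = x∈S
  ... | no  x∉S = contradiction (conjugatesCover⇒∣C∣≤∣S∣ C-grp S-grp S⊆C cover)
                                (ℕ.<⇒≱ (p⊂q⇒∣p∣<∣q∣ (S⊆C , x , x∈C , x∉S)))

  module _ {C : Subset n} (C-grp : IsSubgroup G C) where

    private
      L : Subset n → Set
      L = InInterval G ⊥ C

      class? : ∀ x y → Dec (∃ λ c → c ∈ C × y ≡ conj c x)
      class? x y = any? λ c → (c ∈? C) ×-dec (y ≟ conj c x)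

      class : Fin n → Subset n
      class x = subset (class? x)

      ∈class⁺ : ∀ {x c} → c ∈ C → conj c x ∈ class x
      ∈class⁺ {x} {c} c∈C = ∈subset⁺ (class? x) (c , c∈C , refl)

      ∈class⁻ : ∀ {x y} → y ∈ class x → ∃ λ c → c ∈ C × y ≡ conj c x
      ∈class⁻ {x} = ∈subset⁻ (class? x)

      class-refl : ∀ {x} → x ∈ class x
      class-refl {x} = subst (_∈ class x) (conj-identity x) (∈class⁺ (proj₁ C-grp))

      class-sym : ∀ {x y} → y ∈ class x → x ∈ class y
      class-sym {x} y∈ with ∈class⁻ y∈
      ... | c , c∈C , refl = subst (_∈ class (conj c x)) (conj-inverseˡ c x) (∈class⁺ (proj₂ (proj₂ C-grp) c c∈C))

      class-trans : ∀ {x y z} → y ∈ class x → z ∈ class y → z ∈ class x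
      class-trans {x} y∈ z∈ with ∈class⁻ y∈ | ∈class⁻ z∈
      ... | c , c∈C , refl | d , d∈C , refl =
        subst (_∈ class x) (sym (conj-∙ d c x)) (∈class⁺ (proj₁ (proj₂ C-grp) d c d∈C c∈C))

      class⊆C : ∀ {x} → x ∈ C → class x ⊆ C
      class⊆C x∈C y∈ with ∈class⁻ y∈
      ... | c , c∈C , refl = subgroup-invariant C-grp c∈C x∈C

      IsClassUnion : Subset n → Set
      IsClassUnion Q = Q ⊆ C × Invariant C Q

      invariant-∈class : ∀ {Q x y} → Invariant C Q → y ∈ class x → x ∈ Q → y ∈ Q
      invariant-∈class Q-inv y∈ x∈Q with ∈class⁻ y∈
      ... | c , c∈C , refl = Q-inv c∈C x∈Q

      classUnion⇒L : ∀ {Q} → IsClassUnion Q → L Q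
      classUnion⇒L (Q⊆C , Q-inv) = invariant⇒subrack C-grp Q⊆C Q-inv , ⊥⊆ , Q⊆C

      MeetsEveryClass : Subset n → Set
      MeetsEveryClass W = ∀ {z} → z ∈ C → ∃ λ w → w ∈ W × w ∈ class z

      -- By Jordan, the subgroup of elements of C normalising W is all of C.
      subrack-meetsEveryClass⇒⊇C : ∀ {W} → IsSubrack G W → W ⊆ C → MeetsEveryClass W → C ⊆ W
      subrack-meetsEveryClass⇒⊇C {W} W-rack W⊆C meets {z} z∈C with meets z∈C
      ... | w , w∈W , w∈class with ∈class⁻ w∈class
      ...   | c , c∈C , refl = subst (_∈ W) (conj-inverseˡ c z) (normaliser-invariant W c⁻¹∈N w∈W)
        where
        cover : ConjugatesCover C (normaliser W ∩ C)
        cover x∈C with meets x∈C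
        ... | w′ , w′∈W , w′∈class with ∈class⁻ w′∈class
        ...   | d , d∈C , refl = d , d∈C , x∈p∩q⁺ (subrack⊆normaliser W-rack w′∈W , W⊆C w′∈W)
        C⊆N∩C : C ⊆ normaliser W ∩ C
        C⊆N∩C = conjugatesCover⇒⊆ C-grp (∩-isSubgroup (normaliser-isSubgroup W) C-grp) (p∩q⊆q _ C) cover
        c⁻¹∈N : c ⁻¹ ∈ normaliser W
        c⁻¹∈N = proj₂ (proj₂ (normaliser-isSubgroup W)) c (p∩q⊆p _ C (C⊆N∩C c∈C))

      missesClass : ∀ {W} → W ⊆ C → ¬ MeetsEveryClass W → ∃ λ z → z ∈ C × W ⊆ C ─ class z
      missesClass {W} W⊆C ¬meets
        with ¬∀⟶∃¬ n _ (λ z → z ∈? C →-dec any? (λ w → w ∈? W ×-dec w ∈? class z)) (λ meets → ¬meets (meets _))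
      ... | z , ¬[z∈C⇒meets] with ¬[A→B]⇒A×¬B (z ∈? C) ¬[z∈C⇒meets]
      ...   | z∈C , ¬meets-z = z , z∈C , λ {w} w∈W →
        x∈p∧x∉q⇒x∈p─q (W⊆C w∈W) (λ w∈class → ¬meets-z (w , w∈W , w∈class))

      C─class-isClassUnion : ∀ x → IsClassUnion (C ─ class x)
      C─class-isClassUnion x = p─q⊆p C (class x) , λ {c} c∈C {y} y∈ →
        x∈p∧x∉q⇒x∈p─q (subgroup-invariant C-grp c∈C (p─q⊆p C _ y∈))
                      (λ cyc⁻¹∈ → x∈p─q⇒x∉q y∈ (class-trans cyc⁻¹∈ (class-sym (∈class⁺ c∈C))))

      x∉C─class : ∀ x → x ∉ C ─ class x
      x∉C─class x x∈ = x∈p─q⇒x∉q x∈ class-refl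

      C─class-isCoatom : ∀ {x} → x ∈ C → IsCoatom L C (C ─ class x)
      C─class-isCoatom {x} x∈C =
          classUnion⇒L (C─class-isClassUnion x) , p─q⊆p C (class x)
        , (λ eq → x∉C─class x (subst (x ∈_) (sym eq) x∈C)) , between
        where
        between : ∀ W → L W → C ─ class x ⊆ W → W ⊆ C → W ≡ C ─ class x ⊎ W ≡ C
        between W (W-rack , _) ⊆W W⊆C with W ≟ₛ (C ─ class x)
        ... | yes eq = inj₁ eq
        ... | no neq with ⊆∧≢⇒⊂ ⊆W (neq ∘ sym)
        ...   | _ , y , y∈W , y∉ = inj₂ (⊆-antisym W⊆C (subrack-meetsEveryClass⇒⊇C W-rack W⊆C meets))
          where
          y∈class : y ∈ class x
          y∈class = decidable-stable (y ∈? class x) (λ y∉class → y∉ (x∈p∧x∉q⇒x∈p─q (W⊆C y∈W) y∉class))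
          meets : MeetsEveryClass W
          meets {z} z∈C with z ∈? class x
          ... | yes z∈class = y , y∈W , class-trans (class-sym z∈class) y∈class
          ... | no  z∉class = z , ⊆W (x∈p∧x∉q⇒x∈p─q z∈C z∉class) , class-refl

      coatom⇒classUnion : ∀ {W} → IsCoatom L C W → IsClassUnion W
      coatom⇒classUnion {W} ((W-rack , _ , W⊆C) , _ , W≢C , between)
        with missesClass W⊆C (λ meets → W≢C (⊆-antisym W⊆C (subrack-meetsEveryClass⇒⊇C W-rack W⊆C meets)))
      ... | z , z∈C , W⊆C─class
        with between (C ─ class z) (classUnion⇒L (C─class-isClassUnion z)) W⊆C─class (p─q⊆p C _)
      ...   | inj₁ C─class≡W = subst IsClassUnion C─class≡W (C─class-isClassUnion z)
      ...   | inj₂ C─class≡C = contradiction (subst (z ∈_) (sym C─class≡C) z∈C) (x∉C─class z)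

      ⋂∩-isClassUnion : ∀ {S} → All IsClassUnion S → IsClassUnion (⋂ S ∩ C)
      ⋂∩-isClassUnion {S} S-unions = p∩q⊆q (⋂ S) C , λ c∈C q∈ →
        let q∈⋂S , q∈C = x∈p∩q⁻ (⋂ S) C q∈
        in x∈p∩q⁺ ( ∈⋂⁺ (All.zipWith (λ ((_ , X-inv) , q∈X) → X-inv c∈C q∈X) (S-unions , ∈⋂⁻ S q∈⋂S))
                  , subgroup-invariant C-grp c∈C q∈C)

      Int⇒classUnion : ∀ {Q} → InInt L C Q → IsClassUnion Q
      Int⇒classUnion {Q} (S , S-coatoms , Q-meet) =
        subst IsClassUnion (meet-unique (⋂∩-isMeetIn (subgroup⇒subrack C-grp) S (All.map proj₁ S-coatoms)) Q-meet)
              (⋂∩-isClassUnion (All.map coatom⇒classUnion S-coatoms))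

      -- Q is the meet of the complements of the classes it misses.
      classUnion⇒Int : ∀ {Q} → IsClassUnion Q → InInt L C Q
      classUnion⇒Int {Q} Q-union@(Q⊆C , Q-inv) =
        map (λ x → C ─ class x) missed , coatoms , classUnion⇒L Q-union , Q⊆coatoms , glb
        where
        missed? : ∀ x → Dec (x ∈ C × x ∉ Q)
        missed? x = x ∈? C ×-dec ¬? (x ∈? Q)
        missed : List (Fin n)
        missed = filter missed? (allFin n)
        coatoms : All (IsCoatom L C) (map (λ x → C ─ class x) missed)
        coatoms = map⁺ (All.map (λ (x∈C , _) → C─class-isCoatom x∈C) (all-filter missed? (allFin n)))
        Q⊆coatoms : All (Q ⊆_) (map (λ x → C ─ class x) missed)
        Q⊆coatoms = map⁺ (All.map (λ (_ , x∉Q) {q} q∈Q → x∈p∧x∉q⇒x∈p─q (Q⊆C q∈Q)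
                                     (λ q∈class → x∉Q (invariant-∈class Q-inv (class-sym q∈class) q∈Q)))
                                  (all-filter missed? (allFin n)))
        glb : ∀ W → L W → All (W ⊆_) (map (λ x → C ─ class x) missed) → W ⊆ Q
        glb W (_ , _ , W⊆C) W⊆coatoms {w} w∈W = decidable-stable (w ∈? Q) λ w∉Q →
          x∉C─class w (All.lookup (map⁻ W⊆coatoms) (∈-filter⁺ missed? (∈-allFin w) (W⊆C w∈W , w∉Q)) w∈W)

      representative? : ∀ r → Dec (r ∈ C × ∀ y → y ∈ class r → r ≤ᶠ y)
      representative? r = r ∈? C ×-dec all? (λ y → y ∈? class r →-dec r ≤ᶠ? y)

      representatives : Subset n
      representatives = subset representative?

      representative : ∀ {x} → x ∈ C → ∃ λ r → r ∈ representatives × r ∈ class x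
      representative {x} x∈C with least∈ (class-refl {x})
      ... | r , r∈class , r-least =
        r , ∈subset⁺ representative? (class⊆C x∈C r∈class , λ y y∈ → r-least (class-trans r∈class y∈)) , r∈class

      representative-unique : ∀ {r r′} → r ∈ representatives → r′ ∈ representatives → r′ ∈ class r → r ≡ r′
      representative-unique r∈ r′∈ r′∈class =
        ≤ᶠ-antisym (proj₂ (∈subset⁻ representative? r∈) _ r′∈class)
                      (proj₂ (∈subset⁻ representative? r′∈) _ (class-sym r′∈class))

      saturation? : ∀ P x → Dec (x ∈ C × ∃ λ r → r ∈ P × r ∈ class x)
      saturation? P x = x ∈? C ×-dec any? (λ r → r ∈? P ×-dec r ∈? class x)

      saturation : Subset n → Subset n
      saturation P = subset (saturation? P)

      saturation-mono : ∀ {P P′} → P ⊆ P′ → saturation P ⊆ saturation P′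
      saturation-mono {P} {P′} P⊆P′ x∈ with ∈subset⁻ (saturation? P) x∈
      ... | x∈C , r , r∈P , r∈class = ∈subset⁺ (saturation? P′) (x∈C , r , P⊆P′ r∈P , r∈class)

      saturation-isClassUnion : ∀ P → IsClassUnion (saturation P)
      saturation-isClassUnion P = (λ x∈ → proj₁ (∈subset⁻ (saturation? P) x∈)) , λ c∈C x∈ →
        let x∈C , r , r∈P , r∈class = ∈subset⁻ (saturation? P) x∈
        in ∈subset⁺ (saturation? P) ( subgroup-invariant C-grp c∈C x∈C , r , r∈P
                                    , class-trans (class-sym (∈class⁺ c∈C)) r∈class)

      saturation-representatives : ∀ {Q} → IsClassUnion Q → saturation (representatives ∩ Q) ≡ Q
      saturation-representatives {Q} (Q⊆C , Q-inv) = ⊆-antisym sat⊆Q Q⊆sat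
        where
        sat⊆Q : saturation (representatives ∩ Q) ⊆ Q
        sat⊆Q x∈ with ∈subset⁻ (saturation? _) x∈
        ... | _ , r , r∈R∩Q , r∈class = invariant-∈class Q-inv (class-sym r∈class) (p∩q⊆q _ Q r∈R∩Q)
        Q⊆sat : Q ⊆ saturation (representatives ∩ Q)
        Q⊆sat x∈Q with representative (Q⊆C x∈Q)
        ... | r , r∈R , r∈class =
          ∈subset⁺ (saturation? _) (Q⊆C x∈Q , r , x∈p∩q⁺ (r∈R , invariant-∈class Q-inv r∈class x∈Q) , r∈class)

      representatives∩saturation : ∀ {P} → P ⊆ representatives → representatives ∩ saturation P ≡ representatives ∩ P
      representatives∩saturation {P} P⊆R = ⊆-antisym R∩sat⊆R∩P R∩P⊆R∩sat
        where
        R∩sat⊆R∩P : representatives ∩ saturation P ⊆ representatives ∩ P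
        R∩sat⊆R∩P x∈ with x∈p∩q⁻ representatives _ x∈
        ... | x∈R , x∈sat with ∈subset⁻ (saturation? P) x∈sat
        ...   | _ , r , r∈P , r∈class =
          x∈p∩q⁺ (x∈R , subst (_∈ P) (sym (representative-unique x∈R (P⊆R r∈P) r∈class)) r∈P)
        R∩P⊆R∩sat : representatives ∩ P ⊆ representatives ∩ saturation P
        R∩P⊆R∩sat x∈ with x∈p∩q⁻ representatives P x∈
        ... | x∈R , x∈P =
          x∈p∩q⁺ (x∈R , ∈subset⁺ (saturation? P) (proj₁ (∈subset⁻ representative? x∈R) , _ , x∈P , class-refl))

    -- Int([∅, C]) consists of the unions of C-classes; restricting to class representatives makes it Boolean.
    subgroup⇒Int-isBoolean : IsoToBoolean (InInt (InInterval G ⊥ C) C)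
    subgroup⇒Int-isBoolean = ∣ representatives ∣ , f , g , gf , fg , f-ord
      where
      Elem : Set
      Elem = Σ (Subset n) (InInt L C)
      f : Elem → Subset ∣ representatives ∣
      f (Q , _) = restrict representatives Q
      g : Subset ∣ representatives ∣ → Elem
      g Y = saturation (extend representatives Y) , classUnion⇒Int (saturation-isClassUnion _)
      gf : ∀ Q → proj₁ (g (f Q)) ≡ proj₁ Q
      gf (Q , Q-int) = trans (cong saturation (extend-restrict representatives Q))
                             (saturation-representatives (Int⇒classUnion Q-int))
      fg : ∀ Y → f (g Y) ≡ Y
      fg Y = trans (restrict-cong representatives (representatives∩saturation (extend⊆ representatives Y)))
                   (restrict-extend representatives Y)
      f-ord : ∀ Q Q′ → (proj₁ Q ⊆ proj₁ Q′) ⇔ (f Q ⊆ f Q′)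
      f-ord Q Q′ = mk⇔ (restrict-mono representatives)
                       (λ fQ⊆fQ′ → subst₂ _⊆_ (gf Q) (gf Q′) (saturation-mono (extend-mono representatives fQ⊆fQ′)))

  ∪normaliser─closure-isSubrack : ∀ {R} → IsSubrack G R → IsSubrack G (R ∪ (normaliser R ─ closure G R))
  ∪normaliser─closure-isSubrack {R} R-rack = invariant⇒subrack N-grp Q⊆N Q-inv
    where
    N-grp : IsSubgroup G (normaliser R)
    N-grp = normaliser-isSubgroup R
    Q⊆N : R ∪ (normaliser R ─ closure G R) ⊆ normaliser R
    Q⊆N x∈ = [ subrack⊆normaliser R-rack , p─q⊆p (normaliser R) _ ]′ (x∈p∪q⁻ R _ x∈)
    Q-inv : Invariant (normaliser R) (R ∪ (normaliser R ─ closure G R))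
    Q-inv {a} a∈N x∈ = x∈p∪q⁺ ([ inj₁ ∘ normaliser-invariant R a∈N , inj₂ ∘ stays ]′ (x∈p∪q⁻ R _ x∈))
      where
      stays : ∀ {x} → x ∈ normaliser R ─ closure G R → conj a x ∈ normaliser R ─ closure G R
      stays {x} x∈N─R̄ = x∈p∧x∉q⇒x∈p─q (subgroup-invariant N-grp a∈N (p─q⊆p _ _ x∈N─R̄)) λ axa⁻¹∈R̄ →
        x∈p─q⇒x∉q x∈N─R̄ (subst (_∈ closure G R) (conj-inverseˡ a x) (closure-invariant R ∈⊤ axa⁻¹∈R̄))

  -- Apply (B) to R ∪ (N ─ closure R), N the normaliser of R: as closure R ⊈ R, it must equal R.
  InM⇒normaliser⊆closure : ∀ {R} → InM G R → normaliser R ⊆ closure G R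
  InM⇒normaliser⊆closure {R} (R-rack , R̄≢R , between , _) {x} x∈N
    with Equivalence.to (between _) (∪normaliser─closure-isSubrack R-rack , p⊆p∪q _ , ⊆⊤)
  ... | inj₁ Q≡R = decidable-stable (x ∈? closure G R) λ x∉R̄ →
    x∉R̄ (⊆closure (subst (x ∈_) Q≡R (x∈p∪q⁺ (inj₂ (x∈p∧x∉q⇒x∈p─q x∈N x∉R̄)))))
  ... | inj₂ (_ , R̄⊆Q , _) = contradiction (⊆-antisym R̄⊆R ⊆closure) R̄≢R
    where
    R̄⊆R : closure G R ⊆ R
    R̄⊆R y∈R̄ = [ id , (λ y∈N─R̄ → contradiction y∈R̄ (x∈p─q⇒x∉q y∈N─R̄)) ]′ (x∈p∪q⁻ R _ (R̄⊆Q y∈R̄))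

  InM⇒subgroup : ∀ {R} → InM G R → IsSubgroup G R
  InM⇒subgroup {R} R∈M@(R-rack , _ , between , _ , ¬Boolean)
    with Equivalence.to (between _) (subgroup⇒subrack (normaliser-isSubgroup R) , subrack⊆normaliser R-rack , ⊆⊤)
  ... | inj₁ N≡R = subst (IsSubgroup G) N≡R (normaliser-isSubgroup R)
  ... | inj₂ (_ , R̄⊆N , _) = contradiction (subgroup⇒Int-isBoolean R̄-grp) ¬Boolean
    where
    R̄-grp : IsSubgroup G (closure G R)
    R̄-grp = subst (IsSubgroup G) (⊆-antisym (InM⇒normaliser⊆closure R∈M) R̄⊆N) (normaliser-isSubgroup R)

  InM⇒nonNormal : ∀ {R} → InM G R → ¬ IsNormal G R
  InM⇒nonNormal (_ , R̄≢R , _) R-normal = R̄≢R (invariant⇒closed (λ {g} _ h∈ → R-normal g _ h∈))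

  module _ {M : Subset n} (M-max : IsMaximalSubgroup G M) (M-nonNormal : ¬ IsNormal G M) where

    private
      M-grp : IsSubgroup G M
      M-grp = proj₁ M-max

      M̄ : Subset n
      M̄ = closure G M

      L : Subset n → Set
      L = InInterval G ⊥ M̄

      M̄≢M : M̄ ≢ M
      M̄≢M M̄≡M = M-nonNormal λ g h h∈M → subst (conj g h ∈_) M̄≡M (∈closure⁺ g h∈M)

      M̄-rack : IsSubrack G M̄
      M̄-rack = invariant⇒subrack ⊤-isSubgroup ⊆⊤ (closure-invariant M)

      ⊋M⇒invariant : ∀ {Q} → IsSubrack G Q → M ⊆ Q → Q ≢ M → Invariant ⊤ Q
      ⊋M⇒invariant Q-rack M⊆Q Q≢M = maximal⊂subrack⇒invariant M-max Q-rack (⊆∧≢⇒⊂ M⊆Q (Q≢M ∘ sym))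

      M-between : ∀ Q → InInterval G M ⊤ Q ⇔ (Q ≡ M ⊎ InInterval G M̄ ⊤ Q)
      M-between Q = mk⇔ to from
        where
        to : InInterval G M ⊤ Q → Q ≡ M ⊎ InInterval G M̄ ⊤ Q
        to (Q-rack , M⊆Q , _) with Q ≟ₛ M
        ... | yes Q≡M = inj₁ Q≡M
        ... | no  Q≢M = inj₂ (Q-rack , closure-least (⊋M⇒invariant Q-rack M⊆Q Q≢M) M⊆Q , ⊆⊤)
        from : Q ≡ M ⊎ InInterval G M̄ ⊤ Q → InInterval G M ⊤ Q
        from (inj₁ refl)                = subgroup⇒subrack M-grp , ⊆-refl , ⊆⊤
        from (inj₂ (Q-rack , M̄⊆Q , _)) = Q-rack , ⊆-trans ⊆closure M̄⊆Q , ⊆⊤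

      above-M̄-closed : ∀ Q → InInterval G M̄ ⊤ Q → IsClosed G Q
      above-M̄-closed Q (Q-rack , M̄⊆Q , _) = invariant⇒closed (⊋M⇒invariant Q-rack (⊆-trans ⊆closure M̄⊆Q)
        (λ Q≡M → M̄≢M (⊆-antisym (subst (M̄ ⊆_) Q≡M M̄⊆Q) ⊆closure)))

      conjugate-isCoatom : ∀ g → IsCoatom L M̄ (conjugate g M)
      conjugate-isCoatom g = (gMg⁻¹-rack , ⊥⊆ , gMg⁻¹⊆M̄) , gMg⁻¹⊆M̄ , gMg⁻¹≢M̄ , between
        where
        gMg⁻¹-rack : IsSubrack G (conjugate g M)
        gMg⁻¹-rack = subgroup⇒subrack (conj-preimage-isSubgroup (g ⁻¹) M-grp)
        gMg⁻¹⊆M̄ : conjugate g M ⊆ M̄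
        gMg⁻¹⊆M̄ {z} z∈ = subst (_∈ M̄) (conj-inverseʳ g z) (∈closure⁺ g (∈conj-preimage⁻ z∈))
        gMg⁻¹≢M̄ : conjugate g M ≢ M̄
        gMg⁻¹≢M̄ eq = M̄≢M (⊆-antisym (λ {z} z∈M̄ → subst (_∈ M) (conj-inverseˡ g z)
                         (∈conj-preimage⁻ (subst (conj g z ∈_) (sym eq) (closure-invariant M ∈⊤ z∈M̄)))) ⊆closure)
        between : ∀ W → L W → conjugate g M ⊆ W → W ⊆ M̄ → W ≡ conjugate g M ⊎ W ≡ M̄
        between W (W-rack , _) ⊆W W⊆M̄ with W ≟ₛ conjugate g M
        ... | yes eq = inj₁ eq
        ... | no neq = inj₂ (⊆-antisym W⊆M̄ (closure-least W-inv M⊆W))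
          where
          W-inv : Invariant ⊤ W
          W-inv = maximal⊂subrack⇒invariant (conjugate-isMaximal g M-max) W-rack (⊆∧≢⇒⊂ ⊆W (neq ∘ sym))
          M⊆W : M ⊆ W
          M⊆W {m} m∈M = subst (_∈ W) (conj-inverseˡ g m) (W-inv ∈⊤ (⊆W (∈conjugate⁺ g m∈M)))

      M-isCoatom : IsCoatom L M̄ M
      M-isCoatom = subst (IsCoatom L M̄) (conjugate-identity M) (conjugate-isCoatom ε)

      conjugate≢ : ∀ {g} → g ∉ M → conjugate g M ≢ M
      conjugate≢ {g} g∉M gMg⁻¹≡M = M-nonNormal λ h m m∈M → normaliser-invariant M (⊤⊆N ∈⊤) m∈M
        where
        g∈N : g ∈ normaliser M
        g∈N = ∈normaliser⁺ λ w w∈M → subst (conj g w ∈_) gMg⁻¹≡M (∈conjugate⁺ g w∈M)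
                                  , ∈conj-preimage⁻ (subst (w ∈_) (sym gMg⁻¹≡M) w∈M)
        ⊤⊆N : ⊤ ⊆ normaliser M
        ⊤⊆N = maximal⊂subgroup⇒⊤ M-max (normaliser-isSubgroup M)
                (subrack⊆normaliser (subgroup⇒subrack M-grp) , g , g∈N , g∉M)

      outside? : ∀ g → Dec (g ∉ M)
      outside? g = ¬? (g ∈? M)

      other-conjugates : List (Subset n)
      other-conjugates = map (λ g → conjugate g M) (filter outside? (allFin n))

      other-conjugates-coatoms : All (λ c → IsCoatom L M̄ c × c ≢ M) other-conjugates
      other-conjugates-coatoms = map⁺ (All.map (λ {g} g∉M → conjugate-isCoatom g , conjugate≢ g∉M)
                                               (all-filter outside? (allFin n)))

      -- z ∉ M implies z ∉ z M z⁻¹.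
      ⋂other-conjugates⊆M : ⋂ other-conjugates ∩ M̄ ⊆ M
      ⋂other-conjugates⊆M {z} z∈ = decidable-stable (z ∈? M) λ z∉M →
        z∉M (subst (_∈ M) (conj-⁻¹-self z) (∈conj-preimage⁻ (All.lookup (map⁻ (∈⋂⁻ other-conjugates (p∩q⊆p _ M̄ z∈)))
                                                            (∈-filter⁺ outside? (∈-allFin z) z∉M))))

      Int-notBoolean : ¬ IsoToBoolean (InInt L M̄)
      Int-notBoolean = coatom⊇meet⇒¬Boolean L (λ _ (_ , _ , W⊆M̄) → W⊆M̄) (M̄-rack , ⊥⊆ , ⊆-refl)
        other-conjugates M-isCoatom other-conjugates-coatoms
        (⋂∩-isMeetIn M̄-rack other-conjugates (All.map (proj₁ ∘ proj₁) other-conjugates-coatoms))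
        ⋂other-conjugates⊆M

    maximal-nonNormal⇒InM : InM G M
    maximal-nonNormal⇒InM = subgroup⇒subrack M-grp , M̄≢M , M-between , above-M̄-closed , Int-notBoolean

lemma3p4 : {n : ℕ} (G : FinGroup n) →
    ((R : Subset n) → InM G R → IsSubgroup G R × ¬ IsNormal G R)
    × ((M : Subset n) → IsMaximalSubgroup G M → ¬ IsNormal G M → InM G M)
lemma3p4 G = (λ R R∈M → InM⇒subgroup G R∈M , InM⇒nonNormal G R∈M)
           , (λ M → maximal-nonNormal⇒InM G)
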